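{- Let $D=(V,A)$ be a directed graph, $s,t\in V$ distinct, and $c:A\to\mathbb{R}_{\geq 0}$ an arc cost function. Let $p$ be a shortest $s$-$t$-path in $D$ with respect to $c$, and let $\ell$ be the number of arcs of $p$. Define $\gamma_p:A\to\mathbb{R}^2_{\geq 0}$ by $\gamma_{p,1}(a)=c(a)$ for all $a\in A$, and $\gamma_{p,2}(a)=1$ if $a\in p$ and $\gamma_{p,2}(a)=0$ otherwise. Consider the biobjective shortest path instance $(D,s,t,\gamma_p)$. Then a lexicographically smallest (with respect to $\gamma_p$) efficient $s$-$t$-path $q$ with $\gamma_{p,2}(q)<\ell$ in this instance is a second shortest simple $s$-$t$-path in $D$ with respect to $c$, i.e. $q$ is a simple $s$-$t$-path, $q\neq p$, and $c(q)\leq c(q')$ for every simple $s$-$t$-path $q'\neq p$.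
   Context: Paths are sequences of arcs; the cost of a path under a (vector) arc cost function is the (componentwise) sum of the costs of its arcs. In the biobjective instance $(D,s,t,\gamma_p)$ the feasible solutions are the simple $s$-$t$-paths of $D$. A path $q'$ dominates $q$ if $\gamma_{p,i}(q')\leq\gamma_{p,i}(q)$ for $i\in\{1,2\}$ with at least one inequality strict; a feasible path is efficient if no feasible path dominates it. The lexicographic order compares $\gamma_{p,1}$ first and then $\gamma_{p,2}$.
   Formalization: The arc cost function c takes values in the nonnegative rationals instead of $\mathbb{R}_{\geq 0}$. -}

module Defs where

open import Data.Nat using (ℕ)
open import Data.Fin using (Fin)
open import Data.Fin.Properties using (_≟_)
open import Data.List using (List; []; _∷_; map; foldr; length)
open import Data.List.Relation.Unary.Unique.Propositional using (Unique)
open import Data.List.Membership.DecPropositional {A = ℕ} Data.Nat._≟_ using ()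
open import Data.List.Membership.Propositional using (_∈_)
open import Data.List.Membership.Propositional.Properties using ()
open import Data.Integer using (+_)
open import Data.Rational using (ℚ; 0ℚ; 1ℚ; _+_; _≤_; _<_; _/_)
open import Data.Product using (_×_)
open import Data.Sum using (_⊎_)
open import Relation.Nullary using (¬_; does)
open import Relation.Binary.PropositionalEquality using (_≡_)
open import Data.Bool using (if_then_else_)
import Data.List.Relation.Unary.Any as Any

record Digraph : Set where
  field
    nV nA : ℕ
    tail head : Fin nA → Fin nV
open Digraph public

Vertex : Digraph → Set
Vertex D = Fin (nV D)

Arc : Digraph → Set
Arc D = Fin (nA D)

data IsWalk (D : Digraph) : Vertex D → List (Arc D) → Vertex D → Set where
  nil  : ∀ {u} → IsWalk D u [] u
  cons : ∀ {u w a as} → tail D a ≡ u → IsWalk D (head D a) as w → IsWalk D u (a ∷ as) w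

vertices : (D : Digraph) → Vertex D → List (Arc D) → List (Vertex D)
vertices D u []       = u ∷ []
vertices D u (a ∷ as) = u ∷ vertices D (head D a) as

SimplePath : (D : Digraph) → Vertex D → Vertex D → List (Arc D) → Set
SimplePath D s t q = IsWalk D s q t × Unique (vertices D s q)

pathCost : (D : Digraph) → (Arc D → ℚ) → List (Arc D) → ℚ
pathCost D f q = foldr (λ a r → f a + r) 0ℚ q

γ₂ : (D : Digraph) → List (Arc D) → Arc D → ℚ
γ₂ D p a = if does (Any.any? (a ≟_) p) then 1ℚ else 0ℚ

Dominates : (D : Digraph) → (c : Arc D → ℚ) → (p : List (Arc D)) →
            List (Arc D) → List (Arc D) → Set
Dominates D c p q' q =
  pathCost D c q' ≤ pathCost D c q × pathCost D (γ₂ D p) q' ≤ pathCost D (γ₂ D p) q ×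
  (pathCost D c q' < pathCost D c q ⊎ pathCost D (γ₂ D p) q' < pathCost D (γ₂ D p) q)

Efficient : (D : Digraph) → Vertex D → Vertex D → (c : Arc D → ℚ) →
            List (Arc D) → List (Arc D) → Set
Efficient D s t c p q =
  SimplePath D s t q × (∀ q' → SimplePath D s t q' → ¬ Dominates D c p q' q)

LexLeq : (D : Digraph) → (c : Arc D → ℚ) → (p : List (Arc D)) →
         List (Arc D) → List (Arc D) → Set
LexLeq D c p q q' =
  pathCost D c q < pathCost D c q' ⊎
  (pathCost D c q ≡ pathCost D c q' × pathCost D (γ₂ D p) q ≤ pathCost D (γ₂ D p) q')

ℓ : (D : Digraph) → List (Arc D) → ℚ
ℓ D p = + (length p) / 1

LexMinEfficientBelow : (D : Digraph) → Vertex D → Vertex D → (c : Arc D → ℚ) →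
                       List (Arc D) → List (Arc D) → Set
LexMinEfficientBelow D s t c p q =
  Efficient D s t c p q × pathCost D (γ₂ D p) q < ℓ D p ×
  (∀ q' → Efficient D s t c p q' → pathCost D (γ₂ D p) q' < ℓ D p → LexLeq D c p q q')

-- A simple path all of whose arcs lie on another simple path with the same ends
-- equals it, so every simple s-t-path q' ≠ p misses an arc of p; as the arcs of q'
-- are distinct, γ_{p,2}(q') < ℓ.
-- Among the finitely many simple paths with γ_{p,2} < ℓ a lexicographic minimum m
-- is efficient, because whatever dominates m also has γ_{p,2} < ℓ; hence
-- c(q) ≤ c(m) ≤ c(q').  Since γ_{p,2}(p) = ℓ, q ≠ p.
module Submission where

open import Defs
open import Data.Nat as ℕ using (ℕ; suc; z≤n; s≤s)
import Data.Nat.Properties as ℕ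
open import Data.Nat.Coprimality using (1-coprimeTo) renaming (sym to coprime-sym)
open import Data.Integer as ℤ using (+_)
import Data.Integer.Properties as ℤ
open import Data.Rational using (ℚ; 0ℚ; 1ℚ; mkℚ; _+_; _≤_; _<_; _/_; *<*)
open import Data.Rational.Properties
  using ( normalize-coprime; +-identityˡ; /-cong; ≤-decTotalOrder; ≤-reflexive; ≤-trans
        ; ≤-antisym; <-irrefl; <⇒≤; ≤-<-trans; <-≤-trans; _<?_)
open import Data.Fin.Properties using (_≟_)
open import Data.List
  using (List; []; _∷_; _++_; [_]; length; filter; allFin; cartesianProductWith)
open import Data.List.Properties using (length-++-sucʳ; length-tabulate; filter-all)
open import Data.List.Membership.Propositional using (_∈_; _∉_; find)
open import Data.List.Membership.Propositional.Properties
  using ( ∈-∃++; ∈-++⁻; ∈-++⁺ˡ; ∈-++⁺ʳ; ∈-allFin; ∈-cartesianProductWith⁺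
        ; ∈-filter⁺; ∈-filter⁻)
open import Data.List.Relation.Binary.Subset.Propositional using (_⊆_)
open import Data.List.Relation.Unary.Any using (here; there)
open import Data.List.Relation.Unary.All as All using (All)
open import Data.List.Relation.Unary.All.Properties using (¬Any⇒All¬; ¬All⇒Any¬; all-filter)
open import Data.List.Relation.Unary.AllPairs using (_∷_)
open import Data.List.Relation.Unary.Unique.Propositional using (Unique; [])
open import Data.List.Relation.Unary.Unique.Propositional.Properties using (Unique[x∷xs]⇒x∉xs)
import Data.List.Relation.Unary.Unique.Propositional.Properties as Unique
open import Data.Product using (_×_; ∃; _,_; proj₁; proj₂)
open import Data.Product.Relation.Binary.Lex.NonStrict using (×-decTotalOrder)
open import Data.Sum using (inj₁; inj₂)
open import Data.Empty using (⊥-elim)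
open import Function using (_∘_)
open import Relation.Binary.Bundles using (DecTotalOrder; TotalOrder)
open import Relation.Nullary using (¬_; Dec; yes; no)
open import Relation.Nullary.Decidable using (_×-dec_)
open import Relation.Binary.PropositionalEquality
  using (_≡_; _≢_; refl; sym; trans; cong; subst; subst₂)

private
  variable
    A : Set

+n/1≡mkℚ : ∀ n → + n / 1 ≡ mkℚ (+ n) 0 (coprime-sym (1-coprimeTo n))
+n/1≡mkℚ n = normalize-coprime _

1+[+n/1]≡+[1+n]/1 : ∀ n → 1ℚ + + n / 1 ≡ + suc n / 1
1+[+n/1]≡+[1+n]/1 n =
  trans (cong (_+_ 1ℚ) (+n/1≡mkℚ n)) (/-cong (cong (ℤ._+_ (+ 1)) (ℤ.*-identityʳ (+ n))) refl)

+n/1-mono-< : ∀ {m n} → m ℕ.< n → + m / 1 < + n / 1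
+n/1-mono-< {m} {n} m<n rewrite +n/1≡mkℚ m | +n/1≡mkℚ n =
  *<* (subst₂ ℤ._<_ (sym (ℤ.*-identityʳ (+ m))) (sym (ℤ.*-identityʳ (+ n))) (ℤ.+<+ m<n))

length-mono-⊆ : {xs ys : List A} → Unique xs → xs ⊆ ys → length xs ℕ.≤ length ys
length-mono-⊆ {xs = []} _ _ = z≤n
length-mono-⊆ {xs = x ∷ xs} (x∉xs ∷ xs!) xs⊆ys with ∈-∃++ (xs⊆ys (here refl))
... | as , bs , refl =
  ℕ.≤-trans (s≤s (length-mono-⊆ xs! xs⊆as++bs)) (ℕ.≤-reflexive (sym (length-++-sucʳ as x bs)))
  where
  xs⊆as++bs : xs ⊆ as ++ bs
  xs⊆as++bs {z} z∈xs with ∈-++⁻ as (xs⊆ys (there z∈xs))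
  ... | inj₁ z∈as = ∈-++⁺ˡ z∈as
  ... | inj₂ (here refl) = ⊥-elim (All.lookup x∉xs z∈xs refl)
  ... | inj₂ (there z∈bs) = ∈-++⁺ʳ as z∈bs

length-<-⊆ : {xs ys : List A} {y : A} →
             Unique xs → xs ⊆ ys → y ∈ ys → y ∉ xs → length xs ℕ.< length ys
length-<-⊆ {xs = xs} xs! xs⊆ys y∈ys y∉xs = length-mono-⊆ (¬Any⇒All¬ xs y∉xs ∷ xs!) λ where
  (here refl) → y∈ys
  (there z∈xs) → xs⊆ys z∈xs

listsUpTo : List A → ℕ → List (List A)
listsUpTo xs ℕ.zero = [ [] ]
listsUpTo xs (suc n) = [] ∷ cartesianProductWith _∷_ xs (listsUpTo xs n)

∈-listsUpTo : ∀ {xs ys : List A} n → ys ⊆ xs → length ys ℕ.≤ n → ys ∈ listsUpTo xs n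
∈-listsUpTo {ys = []} ℕ.zero _ _ = here refl
∈-listsUpTo {ys = []} (suc n) _ _ = here refl
∈-listsUpTo {ys = y ∷ ys} (suc n) ys⊆xs (s≤s |ys|≤n) =
  there (∈-cartesianProductWith⁺ _∷_ (ys⊆xs (here refl)) (∈-listsUpTo n (ys⊆xs ∘ there) |ys|≤n))

module _ {D : Digraph} where

  tail∈vertices : ∀ {u as w a} → IsWalk D u as w → a ∈ as → tail D a ∈ vertices D u as
  tail∈vertices (cons e _) (here refl) = here e
  tail∈vertices (cons _ wk) (there a∈as) = there (tail∈vertices wk a∈as)

  end∈vertices : ∀ {u as w} → IsWalk D u as w → w ∈ vertices D u as
  end∈vertices nil = here refl
  end∈vertices (cons _ wk) = there (end∈vertices wk)

  length-vertices : ∀ u as → length (vertices D u as) ≡ suc (length as)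
  length-vertices u [] = refl
  length-vertices u (a ∷ as) = cong suc (length-vertices (head D a) as)

  tail≢fresh : ∀ {u v as w a} → IsWalk D v as w → u ∉ vertices D v as → a ∈ as → tail D a ≢ u
  tail≢fresh wk u∉ a∈as refl = u∉ (tail∈vertices wk a∈as)

  simple⇒unique-arcs : ∀ {u as w} → IsWalk D u as w → Unique (vertices D u as) → Unique as
  simple⇒unique-arcs nil _ = []
  simple⇒unique-arcs (cons e wk) vs!@(_ ∷ vs′!) =
    All.tabulate (λ a∈as b≡a →
      tail≢fresh wk (Unique[x∷xs]⇒x∉xs vs!) a∈as (trans (cong (tail D) (sym b≡a)) e))
    ∷ simple⇒unique-arcs wk vs′!

  simple-⊆⇒≡ : ∀ {u w ps qs} → IsWalk D u ps w → Unique (vertices D u ps) →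
               IsWalk D u qs w → Unique (vertices D u qs) → ps ⊆ qs → ps ≡ qs
  simple-⊆⇒≡ nil _ nil _ _ = refl
  simple-⊆⇒≡ nil _ (cons _ wq) vq! _ = ⊥-elim (Unique[x∷xs]⇒x∉xs vq! (end∈vertices wq))
  simple-⊆⇒≡ (cons _ _) _ nil _ ps⊆qs with () ← ps⊆qs (here refl)
  simple-⊆⇒≡ {ps = a ∷ ps} {b ∷ qs} (cons ea wp) vp!@(_ ∷ vp′!) (cons _ wq) vq!@(_ ∷ vq′!)
             ps⊆qs with ps⊆qs (here refl)
  ... | there a∈qs = ⊥-elim (tail≢fresh wq (Unique[x∷xs]⇒x∉xs vq!) a∈qs ea)
  ... | here refl = cong (a ∷_) (simple-⊆⇒≡ wp vp′! wq vq′! ps⊆qs′)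
    where
    ps⊆qs′ : ps ⊆ qs
    ps⊆qs′ x∈ps with ps⊆qs (there x∈ps)
    ... | here refl = ⊥-elim (tail≢fresh wp (Unique[x∷xs]⇒x∉xs vp!) x∈ps ea)
    ... | there x∈qs = x∈qs

  simple-≢⇒∃∉ : ∀ {u w ps qs} → IsWalk D u ps w → Unique (vertices D u ps) →
                IsWalk D u qs w → Unique (vertices D u qs) → qs ≢ ps → ∃ λ a → a ∈ ps × a ∉ qs
  simple-≢⇒∃∉ {ps = ps} {qs} wp vp! wq vq! qs≢ps =
    find (¬All⇒Any¬ (_∈? qs) ps λ ps⊆qs →
      qs≢ps (sym (simple-⊆⇒≡ wp vp! wq vq! (All.lookup ps⊆qs))))
    where open import Data.List.Membership.DecPropositional (_≟_ {nA D}) using (_∈?_)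

  isWalk? : ∀ u as w → Dec (IsWalk D u as w)
  isWalk? u [] w with u ≟ w
  ... | yes refl = yes nil
  ... | no u≢w = no λ { nil → u≢w refl }
  isWalk? u (a ∷ as) w with tail D a ≟ u | isWalk? (head D a) as w
  ... | yes e | yes wk = yes (cons e wk)
  ... | no ¬e | _ = no λ { (cons e _) → ¬e e }
  ... | yes _ | no ¬wk = no λ { (cons _ wk) → ¬wk wk }

  simplePath? : ∀ s t as → Dec (SimplePath D s t as)
  simplePath? s t as = isWalk? s as t ×-dec unique? (vertices D s as)
    where open import Data.List.Relation.Unary.Unique.DecPropositional (_≟_ {nV D}) using (unique?)

  simplePath-length< : ∀ {s t as} → SimplePath D s t as → length as ℕ.< nV D
  simplePath-length< {s} {as = as} (_ , vs!) =
    subst₂ ℕ._≤_ (length-vertices s as) (length-tabulate (λ v → v))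
      (length-mono-⊆ vs! (λ {v} _ → ∈-allFin v))

  module _ (p : List (Arc D)) where
    open import Data.List.Membership.DecPropositional (_≟_ {nA D}) using (_∈?_)

    γ₂-cost≡count : ∀ q → pathCost D (γ₂ D p) q ≡ + length (filter (_∈? p) q) / 1
    γ₂-cost≡count [] = refl
    γ₂-cost≡count (a ∷ q) with a ∈? p
    ... | yes _ = trans (cong (_+_ 1ℚ) (γ₂-cost≡count q))
                        (1+[+n/1]≡+[1+n]/1 (length (filter (_∈? p) q)))
    ... | no _ = trans (+-identityˡ _) (γ₂-cost≡count q)

    γ₂-cost-self : pathCost D (γ₂ D p) p ≡ ℓ D p
    γ₂-cost-self = trans (γ₂-cost≡count p)
      (cong (λ as → + length as / 1) (filter-all (_∈? p) (All.tabulate (λ a∈p → a∈p))))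

    γ₂-cost<ℓ : ∀ {s t q} → SimplePath D s t p → SimplePath D s t q → q ≢ p →
                pathCost D (γ₂ D p) q < ℓ D p
    γ₂-cost<ℓ {q = q} (wp , vp!) (wq , vq!) q≢p with simple-≢⇒∃∉ wp vp! wq vq! q≢p
    ... | a , a∈p , a∉q = subst (_< ℓ D p) (sym (γ₂-cost≡count q))
      (+n/1-mono-< (length-<-⊆ (Unique.filter⁺ (_∈? p) (simple⇒unique-arcs wq vq!))
                                (proj₂ ∘ ∈-filter⁻ (_∈? p) {xs = q})
                                a∈p
                                (a∉q ∘ proj₁ ∘ ∈-filter⁻ (_∈? p) {xs = q})))

ℚ²-lex : TotalOrder _ _ _
ℚ²-lex = DecTotalOrder.totalOrder (×-decTotalOrder ≤-decTotalOrder ≤-decTotalOrder)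

open TotalOrder ℚ²-lex using () renaming (_≤_ to _≤ₗₑₓ_)
open import Data.List.Extrema ℚ²-lex using (argmin; argmin-all; f[argmin]≤f[⊤]; f[argmin]≤f[xs])

≤ₗₑₓ⇒≤₁ : ∀ {x y : ℚ × ℚ} → x ≤ₗₑₓ y → proj₁ x ≤ proj₁ y
≤ₗₑₓ⇒≤₁ (inj₁ (x₁≤y₁ , _)) = x₁≤y₁
≤ₗₑₓ⇒≤₁ (inj₂ (x₁≡y₁ , _)) = ≤-reflexive x₁≡y₁

module LexMin (D : Digraph) (s t : Vertex D) (c : Arc D → ℚ) (p : List (Arc D)) where

  biCost : List (Arc D) → ℚ × ℚ
  biCost q = pathCost D c q , pathCost D (γ₂ D p) q

  LexLeq⇒≤ : ∀ q q′ → LexLeq D c p q q′ → pathCost D c q ≤ pathCost D c q′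
  LexLeq⇒≤ _ _ (inj₁ c<) = <⇒≤ c<
  LexLeq⇒≤ _ _ (inj₂ (c≡ , _)) = ≤-reflexive c≡

  dominates⇒≰ₗₑₓ : ∀ q q′ → Dominates D c p q′ q → ¬ biCost q ≤ₗₑₓ biCost q′
  dominates⇒≰ₗₑₓ _ _ (c′≤c , _ , _) (inj₁ (c≤c′ , c≢c′)) = c≢c′ (≤-antisym c≤c′ c′≤c)
  dominates⇒≰ₗₑₓ _ _ (_ , _ , inj₁ c′<c) (inj₂ (c≡c′ , _)) = <-irrefl (sym c≡c′) c′<c
  dominates⇒≰ₗₑₓ _ _ (_ , _ , inj₂ γ′<γ) (inj₂ (_ , γ≤γ′)) =
    <-irrefl refl (<-≤-trans γ′<γ γ≤γ′)

  Candidate : List (Arc D) → Set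
  Candidate q = SimplePath D s t q × pathCost D (γ₂ D p) q < ℓ D p

  candidate? : ∀ q → Dec (Candidate q)
  candidate? q = simplePath? {D} s t q ×-dec (pathCost D (γ₂ D p) q <? ℓ D p)

  shortArcLists : List (List (Arc D))
  shortArcLists = listsUpTo (allFin (nA D)) (nV D)

  candidates : List (List (Arc D))
  candidates = filter candidate? shortArcLists

  ∈-candidates : ∀ {q} → Candidate q → q ∈ candidates
  ∈-candidates q-cand@(q-simple , _) =
    ∈-filter⁺ candidate?
      (∈-listsUpTo (nV D) (λ {a} _ → ∈-allFin a) (ℕ.<⇒≤ (simplePath-length< q-simple)))
      q-cand

  lexMin : List (Arc D) → List (Arc D)
  lexMin q = argmin biCost q candidates

  lexMin-candidate : ∀ {q} → Candidate q → Candidate (lexMin q)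
  lexMin-candidate q-cand = argmin-all biCost q-cand (all-filter candidate? shortArcLists)

  lexMin-≤ₗₑₓ : ∀ q → biCost (lexMin q) ≤ₗₑₓ biCost q
  lexMin-≤ₗₑₓ q = f[argmin]≤f[⊤] {f = biCost} q candidates

  lexMin-efficient : ∀ {q} → Candidate q → Efficient D s t c p (lexMin q)
  lexMin-efficient {q} q-cand = proj₁ m-cand , λ q′ q′-simple q′-dom →
    dominates⇒≰ₗₑₓ (lexMin q) q′ q′-dom
      (All.lookup (f[argmin]≤f[xs] {f = biCost} q candidates)
                  (∈-candidates (q′-simple , ≤-<-trans (proj₁ (proj₂ q′-dom)) (proj₂ m-cand))))
    where
    m-cand : Candidate (lexMin q)
    m-cand = lexMin-candidate q-cand

theorem3 : (D : Digraph) (s t : Vertex D) → ¬ (s ≡ t) →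
    (c : Arc D → ℚ) → (∀ a → 0ℚ ≤ c a) →
    (p : List (Arc D)) → SimplePath D s t p →
    (∀ q → SimplePath D s t q → pathCost D c p ≤ pathCost D c q) →
    (q : List (Arc D)) → LexMinEfficientBelow D s t c p q →
    SimplePath D s t q × ¬ (q ≡ p) ×
    (∀ q' → SimplePath D s t q' → ¬ (q' ≡ p) → pathCost D c q ≤ pathCost D c q')
theorem3 D s t _ c _ p p-simple _ q (q-efficient , q-below , q-lexMin) =
  proj₁ q-efficient , q≢p , q-cost-minimal
  where
  open LexMin D s t c p

  q≢p : q ≢ p
  q≢p refl = <-irrefl (γ₂-cost-self {D} p) q-below

  q-cost-minimal : ∀ q′ → SimplePath D s t q′ → q′ ≢ p → pathCost D c q ≤ pathCost D c q′
  q-cost-minimal q′ q′-simple q′≢p =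
    ≤-trans (LexLeq⇒≤ q m q≤ₗₑₓm) (≤ₗₑₓ⇒≤₁ (lexMin-≤ₗₑₓ q′))
    where
    q′-cand : Candidate q′
    q′-cand = q′-simple , γ₂-cost<ℓ p p-simple q′-simple q′≢p

    m : List (Arc D)
    m = lexMin q′

    q≤ₗₑₓm : LexLeq D c p q m
    q≤ₗₑₓm = q-lexMin m (lexMin-efficient q′-cand) (proj₂ (lexMin-candidate q′-cand))
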